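{- Let $n\ge 2$, let $\mathcal{V}=\{v_1,\dots,v_n\}$, and let $N_1,\dots,N_n$ be unary connectives, each interpreted by some truth-table $\mathcal{V}\to\mathcal{V}$. Let $\vdash$ denote derivability of located sequents in the natural-deduction system $\mathcal{N}^n$ (described in the context) for this language. Call $v_j\in\mathcal{V}$ a \emph{falsity} if for every $1\le i\le n$, every formula $\varphi$ and all finite sets $\Gamma,\Delta$ of located formulas, the sequent $\Gamma:\Delta,(N_i\varphi,j)$ and the sequent $\Gamma:\Delta,(\varphi,i)$ are interderivable in $\mathcal{N}^n$ (each is derivable from the other taken as a premise). If both $v_j$ and $v_k$ are falsities, then $j=k$.
   Context: A located formula is a pair $(\varphi,k)$ with $\varphi$ a formula of the propositional language built from atoms with the connectives $N_1,\dots,N_n$, and $k\in\{1,\dots,n\}$; it is meant to associate $\varphi$ with the truth-value $v_k$. A located sequent has the form $\Gamma:\Delta$ with $\Gamma,\Delta$ finite sets of located formulas; "$\Gamma:\Delta,(\psi,k)$" means $\Gamma:\Delta\cup\{(\psi,k)\}$, and for a set $S$ of located formulas "$\Gamma:\Delta,S$" means $\Gamma:\Delta\cup S$. A valuation $\sigma$ assigns each atom a value in $\mathcal{V}$ and extends to all formulas by the truth-tables of the connectives; $\sigma$ satisfies $\Gamma:\Delta$ iff whenever $\sigma(\varphi)=v_k$ for all $(\varphi,k)\in\Gamma$, then $\sigma(\psi)=v_j$ for some $(\psi,j)\in\Delta$. The system $\mathcal{N}^n$ (sound and complete for this semantics) has: initial sequents $\Gamma,(\varphi,i):\Delta,(\varphi,i)$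 for each $i$; right shift: from $\Gamma,(\varphi,i):\Delta$ infer $\Gamma:\Delta,\{(\varphi,k)\mid k\ne i\}$; left shift: from $\Gamma:\Delta,(\varphi,i)$ infer $\Gamma,(\varphi,j):\Delta$ for $j\ne i$; coordination $(c_{i,j})$, $i\ne j$: from $\Gamma:\Delta,(\varphi,i)$ and $\Gamma:\Delta,(\varphi,j)$ infer $\Gamma:\Delta$ (weakening on both sides is derivable); and, for each connective $*$ of arity $p$, operational rules generated from its truth-table: if $*(v_{i_1},\dots,v_{i_p})=v_k$, then from $\Gamma:\Delta,(\varphi_m,i_m)$ for $m=1,\dots,p$ infer $\Gamma:\Delta,(*(\varphi_1,\dots,\varphi_p),k)$; and for each $k$, from $\Gamma:\Delta,(*(\varphi_1,\dots,\varphi_p),k)$ together with all sequents $\Gamma,(\varphi_1,k_1),\dots,(\varphi_p,k_p):\Delta$ for which $*(v_{k_1},\dots,v_{k_p})=v_k$, infer $\Gamma:\Delta$. -}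

module Defs where

open import Data.Nat using (ℕ)
open import Data.Fin using (Fin; _≟_)
open import Data.List using (List; []; _∷_; _++_; filter; allFin)
open import Data.List.Membership.Propositional using (_∈_)
open import Data.Product using (_×_; _,_)
open import Relation.Binary.PropositionalEquality using (_≡_)
open import Relation.Nullary using (¬_; ¬?)

-- Truth values v_1..v_n are represented by Fin n.
-- A "table" assigns to each connective index l : Fin n the truth-table of N_l.
Tables : ℕ → Set
Tables n = Fin n → Fin n → Fin n

data Formula (n : ℕ) : Set where
  atom : ℕ → Formula n
  N    : Fin n → Formula n → Formula n

-- Located formula (φ , k): φ associated with the value v_k.
LFormula : ℕ → Set
LFormula n = Formula n × Fin n

-- Finite sets of located formulas are represented by lists, considered up to
-- having the same elements (see the rule `set-eq` below).
LSet : ℕ → Set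
LSet n = List (LFormula n)

Sequent : ℕ → Set
Sequent n = LSet n × LSet n

_≈ˢ_ : ∀ {n} → LSet n → LSet n → Set
Γ ≈ˢ Γ' = (∀ x → x ∈ Γ → x ∈ Γ') × (∀ x → x ∈ Γ' → x ∈ Γ)

others : ∀ {n} → Formula n → Fin n → LSet n
others {n} φ i = Data.List.map (λ k → (φ , k)) (filter (λ k → ¬? (k ≟ i)) (allFin n))

data Deriv {n : ℕ} (t : Tables n) (P : Sequent n → Set) : Sequent n → Set where
  prem   : ∀ {s} → P s → Deriv t P s
  set-eq : ∀ {Γ Δ Γ' Δ'} → Γ ≈ˢ Γ' → Δ ≈ˢ Δ' →
           Deriv t P (Γ , Δ) → Deriv t P (Γ' , Δ')
  init   : ∀ {Γ Δ φ i} → Deriv t P ((φ , i) ∷ Γ , (φ , i) ∷ Δ)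
  shiftR : ∀ {Γ Δ φ i} → Deriv t P ((φ , i) ∷ Γ , Δ) →
           Deriv t P (Γ , Δ ++ others φ i)
  shiftL : ∀ {Γ Δ φ i j} → ¬ (j ≡ i) → Deriv t P (Γ , (φ , i) ∷ Δ) →
           Deriv t P ((φ , j) ∷ Γ , Δ)
  coord  : ∀ {Γ Δ φ i j} → ¬ (i ≡ j) →
           Deriv t P (Γ , (φ , i) ∷ Δ) → Deriv t P (Γ , (φ , j) ∷ Δ) →
           Deriv t P (Γ , Δ)
  N-intro : ∀ {Γ Δ φ} l a k → t l a ≡ k →
            Deriv t P (Γ , (φ , a) ∷ Δ) →
            Deriv t P (Γ , (N l φ , k) ∷ Δ)
  N-elim : ∀ {Γ Δ φ} l k →
           Deriv t P (Γ , (N l φ , k) ∷ Δ) →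
           (∀ a → t l a ≡ k → Deriv t P ((φ , a) ∷ Γ , Δ)) →
           Deriv t P (Γ , Δ)

_⊢[_]_ : ∀ {n} → Sequent n → Tables n → Sequent n → Set
s ⊢[ t ] s' = Deriv t (λ x → x ≡ s) s'

IsFalsity : ∀ {n} → Tables n → Fin n → Set
IsFalsity {n} t j =
  ∀ (i : Fin n) (φ : Formula n) (Γ Δ : LSet n) →
    ((Γ , (N i φ , j) ∷ Δ) ⊢[ t ] (Γ , (φ , i) ∷ Δ)) ×
    ((Γ , (φ , i) ∷ Δ) ⊢[ t ] (Γ , (N i φ , j) ∷ Δ))

{-# OPTIONS --safe #-}
-- By soundness of 𝒩ⁿ, the rule taking Γ : Δ, (φ, i) to Γ : Δ, (N_i φ, j) preserves
-- validity under every valuation. Choosing a valuation with σ(φ) = v_i shows that a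
-- falsity v_j must equal the diagonal table entry N_i(v_i); hence it is unique.
module Submission where

open import Defs
open import Data.Nat using (ℕ; _≤_)
open import Data.Fin using (Fin; _≟_)
open import Data.List using ([])
open import Data.List.Membership.Propositional using (_∈_; lose)
open import Data.List.Membership.Propositional.Properties using (∈-map⁺; ∈-filter⁺; ∈-allFin)
open import Data.List.Relation.Unary.All using (All; []; _∷_)
open import Data.List.Relation.Unary.Any using (Any; here; there)
open import Data.List.Relation.Unary.Any.Properties using (++⁺ˡ; ++⁺ʳ)
open import Data.List.Relation.Binary.Subset.Propositional.Properties using (Any-resp-⊆; All-resp-⊇)
open import Data.Product using (_,_; proj₁; proj₂)
open import Data.Empty using (⊥-elim)
open import Function using (_∘_)
open import Relation.Nullary using (¬_; yes; no; ¬?)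
open import Relation.Binary.PropositionalEquality using (_≡_; refl; sym; trans; cong)

∈-others : ∀ {n} {φ : Formula n} {i k} → ¬ k ≡ i → (φ , k) ∈ others φ i
∈-others {φ = φ} {i} {k} k≢i =
  ∈-map⁺ (λ k → (φ , k)) (∈-filter⁺ (λ k → ¬? (k ≟ i)) (∈-allFin k) k≢i)

module Semantics {n : ℕ} (t : Tables n) (σ : ℕ → Fin n) where

  eval : Formula n → Fin n
  eval (atom x) = σ x
  eval (N l φ)  = t l (eval φ)

  Holds : LFormula n → Set
  Holds (φ , k) = eval φ ≡ k

  Satisfies : Sequent n → Set
  Satisfies (Γ , Δ) = All Holds Γ → Any Holds Δ

  soundness : ∀ {P s} → (∀ {p} → P p → Satisfies p) → Deriv t P s → Satisfies s
  soundness sat (prem p) = sat p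
  soundness sat (set-eq Γ≈Γ' Δ≈Δ' d) =
    Any-resp-⊆ (proj₁ Δ≈Δ' _) ∘ soundness sat d ∘ All-resp-⊇ (proj₁ Γ≈Γ' _)
  soundness sat init (h ∷ _) = here h
  soundness sat (shiftR {Δ = Δ} {φ} {i} d) hs with eval φ ≟ i
  ... | yes φ=i = ++⁺ˡ (soundness sat d (φ=i ∷ hs))
  ... | no φ≠i  = ++⁺ʳ Δ (lose (∈-others φ≠i) refl)
  soundness sat (shiftL j≢i d) (φ=j ∷ hs) with soundness sat d hs
  ... | here φ=i = ⊥-elim (j≢i (trans (sym φ=j) φ=i))
  ... | there a  = a
  soundness sat (coord i≢j d₁ d₂) hs with soundness sat d₁ hs | soundness sat d₂ hs
  ... | here φ=i | here φ=j = ⊥-elim (i≢j (trans (sym φ=i) φ=j))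
  ... | there a  | _        = a
  ... | _        | there a  = a
  soundness sat (N-intro l a k tla=k d) hs with soundness sat d hs
  ... | here φ=a = here (trans (cong (t l) φ=a) tla=k)
  ... | there b  = there b
  soundness sat (N-elim {φ = φ} l k d minor) hs with soundness sat d hs
  ... | here Nφ=k = soundness sat (minor (eval φ) Nφ=k) (refl ∷ hs)
  ... | there b   = b

  soundness-from-premise : ∀ {s s'} → s ⊢[ t ] s' → Satisfies s → Satisfies s'
  soundness-from-premise d sat-s = soundness (λ { refl → sat-s }) d

falsity-is-diagonal : ∀ {n} {t : Tables n} {j} → IsFalsity t j → ∀ i → t i i ≡ j
falsity-is-diagonal {n} {t} {j} falsity i
  with soundness-from-premise (proj₂ (falsity i (atom 0) [] [])) (λ _ → here refl) []
  where open Semantics t (λ _ → i)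
... | here tii=j = tii=j

mainTheorem2 : (n : ℕ) → 2 ≤ n → (t : Tables n) → (j k : Fin n) →
    IsFalsity t j → IsFalsity t k → j ≡ k
mainTheorem2 n _ t j k falsity-j falsity-k =
  trans (sym (falsity-is-diagonal falsity-j j)) (falsity-is-diagonal falsity-k j)
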